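{- Let $a,b,n$ be positive integers with $ab$ odd and $4\mid a-b$. Then $$t(a,2a,b,2b;n)=N(a,2a,b,2b;8n+3(a+b))-N\big(a,2a,b,2b;4n+\tfrac{3(a+b)}2\big).$$
   Context: For positive integers $a_1,\dots,a_k$ and a nonnegative integer $n$, $N(a_1,\dots,a_k;n)$ is the number of $(x_1,\dots,x_k)\in\mathbb Z^k$ with $n=a_1x_1^2+\cdots+a_kx_k^2$, and $t(a_1,\dots,a_k;n)$ is the number of $(x_1,\dots,x_k)\in\mathbb Z^k$ with $n=a_1\frac{x_1(x_1-1)}2+\cdots+a_k\frac{x_k(x_k-1)}2$. -}

module Defs where

open import Data.Nat as ℕ using (ℕ; zero; suc)
open import Data.Integer as ℤ using (ℤ; +_; -[1+_]; _-_; _*_)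
open import Data.Integer.DivMod using (_/_)
open import Data.List using (List; []; _∷_; map; upTo)
open import Data.Nat.ListAction using (sum)
open import Relation.Nullary.Decidable using (⌊_⌋)
open import Data.Bool using (if_then_else_)

box : ℕ → List ℤ
box B = map (λ i → + i) (upTo (suc B)) Data.List.++ map (λ i → -[1+ i ]) (upTo B)

countBox : (ℤ → ℤ) → ℕ → List ℕ → ℤ → ℕ
countBox f B [] m = if ⌊ m ℤ.≟ + 0 ⌋ then 1 else 0
countBox f B (a ∷ as) m = sum (map (λ x → countBox f B as (m - (+ a) * f x)) (box B))

sq : ℤ → ℤ
sq x = x * x

-- triangular-type values x(x-1)/2 (x(x-1) is always even, so exact division)
tri : ℤ → ℤ
tri x = (x * (x - + 1)) / + 2

-- N(a_1,...,a_k; m) for positive a_i and m ≥ 0: every solution satisfies |x_i| ≤ m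
-- (since a_i x_i² ≤ m and x_i² ≥ |x_i|), so the box of radius m is exhaustive.
N : List ℕ → ℕ → ℕ
N as m = countBox sq m as (+ m)

-- t(a_1,...,a_k; n) for positive a_i: every solution satisfies x_i(x_i-1)/2 ≤ n,
-- hence |x_i| ≤ n+1, so the box of radius n+1 is exhaustive.
t : List ℕ → ℕ → ℕ
t as n = countBox tri (suc n) as (+ n)

{-# OPTIONS --safe #-}
module Submission where

-- Put M = 8n + 3(a + b) = 2K.  Reducing a x₁² + 2a x₂² + b x₃² + 2b x₄² = M modulo 2 gives
-- x₁ ≡ x₃ (mod 2).  If x₁ = 2z₁ and x₃ = 2z₃ the equation halves to
-- a x₂² + 2a z₁² + b x₄² + 2b z₃² = K, so these solutions are counted by N(a,2a,b,2b;K).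
-- If x₁ and x₃ are odd, reducing modulo 4 and 8 (this is where a ≡ b (mod 4) enters) forces
-- x₂ and x₄ to be odd too; writing xᵢ = 2yᵢ - 1, so that xᵢ² = 8T(yᵢ) + 1 with T(y) = y(y-1)/2,
-- the equation becomes n = a T(y₁) + 2a T(y₂) + b T(y₃) + 2b T(y₄), counted by t(a,2a,b,2b;n).
-- A count is a sum over a box of an indicator; the parity split reindexes the box [-2K, 2K],
-- and boxes may be shrunk freely as long as they still contain every solution.

open import Data.Integer as ℤ using (ℤ; +_; -[1+_]; ∣_∣)
import Data.Integer.Properties as ℤP
open import Data.List using (List; []; _∷_; [_]; map; upTo; _++_; _∷ʳ_)
open import Data.List.Properties using (map-++; map-cong; map-∘; upTo-∷ʳ)
open import Data.Nat as ℕ using (ℕ; zero; suc; _≤_; _<_; _≤′_; ≤′-refl; ≤′-step; z≤n; s≤s; NonZero)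
open import Data.Nat.ListAction using (sum)
open import Data.Nat.ListAction.Properties using (sum-++)
import Data.Nat.Properties as ℕP
open import Data.Product using (∃; _,_)
open import Data.Sum as Sum using (_⊎_; inj₁; inj₂)
open import Function using (_∘_; _$_)
open import Relation.Binary.PropositionalEquality using (_≡_; refl; sym; trans; cong; cong₂; module ≡-Reasoning)

open import Defs

-- Sums over the boxes [-B, B] and [-B, B]⁴

module _ where
  open import Data.Nat using (_+_; _*_)
  open import Data.Nat.Tactic.RingSolver using (solve-∀)
  open import Algebra.Properties.CommutativeSemigroup ℕP.+-commutativeSemigroup using (interchange)

  private variable
    A : Set

  sum-map-∷ʳ : (h : A → ℕ) (xs : List A) (x : A) → sum (map h (xs ∷ʳ x)) ≡ sum (map h xs) + h x
  sum-map-∷ʳ h xs x = begin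
    sum (map h (xs ++ [ x ]))     ≡⟨ cong sum (map-++ h xs [ x ]) ⟩
    sum (map h xs ++ [ h x ])     ≡⟨ sum-++ (map h xs) [ h x ] ⟩
    sum (map h xs) + (h x + 0)    ≡⟨ cong (_+_ (sum (map h xs))) (ℕP.+-identityʳ (h x)) ⟩
    sum (map h xs) + h x          ∎
    where open ≡-Reasoning

  sum-map-zero : {h : A → ℕ} → (∀ x → h x ≡ 0) → ∀ xs → sum (map h xs) ≡ 0
  sum-map-zero h≡0 []       = refl
  sum-map-zero h≡0 (x ∷ xs) = cong₂ _+_ (h≡0 x) (sum-map-zero h≡0 xs)

  sum-map-+ : (f g : A → ℕ) (xs : List A) → sum (map (λ x → f x + g x) xs) ≡ sum (map f xs) + sum (map g xs)
  sum-map-+ f g []       = refl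
  sum-map-+ f g (x ∷ xs) = trans (cong (_+_ (f x + g x)) (sum-map-+ f g xs)) (interchange (f x) (g x) _ _)

  sum-map-comm : (f : A → A → ℕ) (xs ys : List A) →
    sum (map (λ x → sum (map (f x) ys)) xs) ≡ sum (map (λ y → sum (map (λ x → f x y) xs)) ys)
  sum-map-comm f []       ys = sym (sum-map-zero (λ _ → refl) ys)
  sum-map-comm f (x ∷ xs) ys = trans (cong (_+_ (sum (map (f x) ys))) (sum-map-comm f xs ys))
                                     (sym (sum-map-+ (f x) _ ys))

  sum-upTo-suc : (h : ℕ → ℕ) (n : ℕ) → sum (map h (upTo (suc n))) ≡ sum (map h (upTo n)) + h n
  sum-upTo-suc h n = trans (cong (sum ∘ map h) (sym (upTo-∷ʳ n))) (sum-map-∷ʳ h (upTo n) n)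

  sumBox : ℕ → (ℤ → ℕ) → ℕ
  sumBox B g = sum (map g (box B))

  sumBox-signs : ∀ B g → sumBox B g ≡ sum (map (g ∘ +_) (upTo (suc B))) + sum (map (g ∘ -[1+_]) (upTo B))
  sumBox-signs B g = begin
    sum (map g (map +_ (upTo (suc B)) ++ map -[1+_] (upTo B)))
      ≡⟨ cong sum (map-++ g (map +_ (upTo (suc B))) _) ⟩
    sum (map g (map +_ (upTo (suc B))) ++ map g (map -[1+_] (upTo B)))
      ≡⟨ sum-++ (map g (map +_ (upTo (suc B)))) _ ⟩
    sum (map g (map +_ (upTo (suc B)))) + sum (map g (map -[1+_] (upTo B)))
      ≡⟨ sym (cong₂ _+_ (cong sum (map-∘ (upTo (suc B)))) (cong sum (map-∘ (upTo B)))) ⟩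
    sum (map (g ∘ +_) (upTo (suc B))) + sum (map (g ∘ -[1+_]) (upTo B)) ∎
    where open ≡-Reasoning

  sumBox-suc : ∀ B g → sumBox (suc B) g ≡ sumBox B g + (g (+ suc B) + g -[1+ B ])
  sumBox-suc B g = begin
    sumBox (suc B) g
      ≡⟨ sumBox-signs (suc B) g ⟩
    sum (map (g ∘ +_) (upTo (suc (suc B)))) + sum (map (g ∘ -[1+_]) (upTo (suc B)))
      ≡⟨ cong₂ _+_ (sum-upTo-suc (g ∘ +_) (suc B)) (sum-upTo-suc (g ∘ -[1+_]) B) ⟩
    (sum (map (g ∘ +_) (upTo (suc B))) + g (+ suc B)) + (sum (map (g ∘ -[1+_]) (upTo B)) + g -[1+ B ])
      ≡⟨ interchange (sum (map (g ∘ +_) (upTo (suc B)))) _ _ _ ⟩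
    (sum (map (g ∘ +_) (upTo (suc B))) + sum (map (g ∘ -[1+_]) (upTo B))) + (g (+ suc B) + g -[1+ B ])
      ≡⟨ cong (_+ (g (+ suc B) + g -[1+ B ])) (sym (sumBox-signs B g)) ⟩
    sumBox B g + (g (+ suc B) + g -[1+ B ]) ∎
    where open ≡-Reasoning

  sumBox-cong : ∀ B {g h : ℤ → ℕ} → (∀ x → g x ≡ h x) → sumBox B g ≡ sumBox B h
  sumBox-cong B g≡h = cong sum (map-cong g≡h (box B))

  sumBox-zero : ∀ B {g : ℤ → ℕ} → (∀ x → g x ≡ 0) → sumBox B g ≡ 0
  sumBox-zero B g≡0 = sum-map-zero g≡0 (box B)

  sumBox-+ : ∀ B (g h : ℤ → ℕ) → sumBox B (λ x → g x + h x) ≡ sumBox B g + sumBox B h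
  sumBox-+ B g h = sum-map-+ g h (box B)

  sumBox-comm : ∀ B C (g : ℤ → ℤ → ℕ) →
    sumBox B (λ x → sumBox C (g x)) ≡ sumBox C (λ y → sumBox B (λ x → g x y))
  sumBox-comm B C g = sum-map-comm g (box B) (box C)

  sumBox-restrict : ∀ {s r} {g : ℤ → ℕ} → s ≤ r → (∀ x → s < ∣ x ∣ → g x ≡ 0) → sumBox r g ≡ sumBox s g
  sumBox-restrict {s} {g = g} s≤r vanish = go (ℕP.≤⇒≤′ s≤r)
    where
    go : ∀ {r} → s ≤′ r → sumBox r g ≡ sumBox s g
    go ≤′-refl = refl
    go {suc r} (≤′-step s≤′r) = begin
      sumBox (suc r) g                          ≡⟨ sumBox-suc r g ⟩
      sumBox r g + (g (+ suc r) + g -[1+ r ])   ≡⟨ cong₂ (λ u v → sumBox r g + (u + v)) (vanish _ s<1+r) (vanish _ s<1+r) ⟩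
      sumBox r g + 0                            ≡⟨ ℕP.+-identityʳ _ ⟩
      sumBox r g                                ≡⟨ go s≤′r ⟩
      sumBox s g                                ∎
      where
      open ≡-Reasoning
      s<1+r = s≤s (ℕP.≤′⇒≤ s≤′r)

  data Parity : Set where
    even odd : Parity

  -- every integer in [-2K-1, 2K] is embed p z for exactly one p and one z ∈ [-K, K]
  embed : Parity → ℤ → ℤ
  embed even z = + 2 ℤ.* z
  embed odd  z = + 2 ℤ.* z ℤ.- + 1

  sumParity : (Parity → ℕ) → ℕ
  sumParity h = h even + h odd

  sumBox-parity : ∀ K g → sumBox (2 * K) g + g -[1+ 2 * K ] ≡ sumParity (λ p → sumBox K (g ∘ embed p))
  sumBox-parity zero g = cong (_+_ (g (+ 0) + 0)) (sym (ℕP.+-identityʳ (g -[1+ 0 ])))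
  sumBox-parity (suc K) g = begin
    sumBox (2 * suc K) g + g -[1+ 2 * suc K ]
      ≡⟨ cong (λ r → sumBox r g + g -[1+ r ]) (ℕP.*-suc 2 K) ⟩
    sumBox (2 + 2 * K) g + g -[1+ 2 + 2 * K ]
      ≡⟨ cong (_+ g -[1+ 2 + 2 * K ]) (trans (sumBox-suc (suc (2 * K)) g)
           (cong (_+ (g (+ (2 + 2 * K)) + g -[1+ suc (2 * K) ])) (sumBox-suc (2 * K) g))) ⟩
    sumBox (2 * K) g + (g (+ suc (2 * K)) + g -[1+ 2 * K ]) + (g (+ (2 + 2 * K)) + g -[1+ suc (2 * K) ])
      + g -[1+ 2 + 2 * K ]
      ≡⟨ regroup (sumBox (2 * K) g) (g (+ suc (2 * K))) (g -[1+ 2 * K ]) (g (+ (2 + 2 * K)) + g -[1+ suc (2 * K) ])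
                 (g -[1+ 2 + 2 * K ]) (sumBox K (g ∘ embed even)) (sumBox K (g ∘ embed odd)) (sumBox-parity K g) ⟩
    sumBox K (g ∘ embed even) + (g (+ (2 + 2 * K)) + g -[1+ suc (2 * K) ])
      + (sumBox K (g ∘ embed odd) + (g (+ suc (2 * K)) + g -[1+ 2 + 2 * K ]))
      ≡⟨ cong₂ (λ u v → sumBox K (g ∘ embed even) + u + (sumBox K (g ∘ embed odd) + v)) evens odds ⟩
    sumBox K (g ∘ embed even) + (g (embed even (+ suc K)) + g (embed even -[1+ K ]))
      + (sumBox K (g ∘ embed odd) + (g (embed odd (+ suc K)) + g (embed odd -[1+ K ])))
      ≡⟨ sym (cong₂ _+_ (sumBox-suc K (g ∘ embed even)) (sumBox-suc K (g ∘ embed odd))) ⟩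
    sumParity (λ p → sumBox (suc K) (g ∘ embed p)) ∎
    where
    open ≡-Reasoning
    regroup : ∀ S p₁ n₁ q n₃ E O → S + n₁ ≡ E + O → S + (p₁ + n₁) + q + n₃ ≡ E + q + (O + (p₁ + n₃))
    regroup S p₁ n₁ q n₃ E O eq = begin
      S + (p₁ + n₁) + q + n₃    ≡⟨ shuffle₁ S p₁ n₁ q n₃ ⟩
      S + n₁ + (p₁ + q + n₃)    ≡⟨ cong (_+ (p₁ + q + n₃)) eq ⟩
      E + O + (p₁ + q + n₃)     ≡⟨ shuffle₂ E O p₁ q n₃ ⟩
      E + q + (O + (p₁ + n₃))   ∎
      where
      shuffle₁ : ∀ S p₁ n₁ q n₃ → S + (p₁ + n₁) + q + n₃ ≡ S + n₁ + (p₁ + q + n₃)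
      shuffle₁ = solve-∀
      shuffle₂ : ∀ E O p₁ q n₃ → E + O + (p₁ + q + n₃) ≡ E + q + (O + (p₁ + n₃))
      shuffle₂ = solve-∀
    evens : g (+ (2 + 2 * K)) + g -[1+ suc (2 * K) ] ≡ g (embed even (+ suc K)) + g (embed even -[1+ K ])
    evens = cong₂ _+_ (cong (g ∘ +_) (sym (ℕP.*-suc 2 K))) (cong (g ∘ -[1+_] ∘ ℕ.pred) (sym (ℕP.*-suc 2 K)))
    odds : g (+ suc (2 * K)) + g -[1+ 2 + 2 * K ] ≡ g (embed odd (+ suc K)) + g (embed odd -[1+ K ])
    odds = cong₂ _+_ (cong (g ∘ +_ ∘ ℕ.pred) (sym (ℕP.*-suc 2 K)))
                       (cong (g ∘ -[1+_] ∘ suc) (trans (sym (ℕP.+-identityʳ (suc (2 * K))))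
                                                        (cong (λ k → ℕ.pred k + 0) (sym (ℕP.*-suc 2 K)))))

  sumBox-split : ∀ K {g : ℤ → ℕ} → g -[1+ 2 * K ] ≡ 0 → sumBox (2 * K) g ≡ sumParity (λ p → sumBox K (g ∘ embed p))
  sumBox-split K {g} g≡0 = begin
    sumBox (2 * K) g                          ≡⟨ sym (ℕP.+-identityʳ _) ⟩
    sumBox (2 * K) g + 0                      ≡⟨ cong (_+_ (sumBox (2 * K) g)) (sym g≡0) ⟩
    sumBox (2 * K) g + g -[1+ 2 * K ]         ≡⟨ sumBox-parity K g ⟩
    sumParity (λ p → sumBox K (g ∘ embed p))  ∎
    where open ≡-Reasoning

  sumBox-sumParity : ∀ B (h : ℤ → Parity → ℕ) → sumBox B (λ x → sumParity (h x)) ≡ sumParity (λ p → sumBox B (λ x → h x p))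
  sumBox-sumParity B h = sumBox-+ B (λ x → h x even) (λ x → h x odd)

  sumParity-cong : {h h′ : Parity → ℕ} → (∀ p → h p ≡ h′ p) → sumParity h ≡ sumParity h′
  sumParity-cong h≡h′ = cong₂ _+_ (h≡h′ even) (h≡h′ odd)

  Σ⁴ : (r₁ r₂ r₃ r₄ : ℕ) → (ℤ → ℤ → ℤ → ℤ → ℕ) → ℕ
  Σ⁴ r₁ r₂ r₃ r₄ g = sumBox r₁ λ x₁ → sumBox r₂ λ x₂ → sumBox r₃ λ x₃ → sumBox r₄ λ x₄ → g x₁ x₂ x₃ x₄

  Σ⁴-cong : ∀ r₁ r₂ r₃ r₄ {g h : ℤ → ℤ → ℤ → ℤ → ℕ} → (∀ x₁ x₂ x₃ x₄ → g x₁ x₂ x₃ x₄ ≡ h x₁ x₂ x₃ x₄) →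
            Σ⁴ r₁ r₂ r₃ r₄ g ≡ Σ⁴ r₁ r₂ r₃ r₄ h
  Σ⁴-cong r₁ r₂ r₃ r₄ g≡h =
    sumBox-cong r₁ λ x₁ → sumBox-cong r₂ λ x₂ → sumBox-cong r₃ λ x₃ → sumBox-cong r₄ λ x₄ → g≡h x₁ x₂ x₃ x₄

  Σ⁴-zero : ∀ r₁ r₂ r₃ r₄ {g : ℤ → ℤ → ℤ → ℤ → ℕ} → (∀ x₁ x₂ x₃ x₄ → g x₁ x₂ x₃ x₄ ≡ 0) → Σ⁴ r₁ r₂ r₃ r₄ g ≡ 0
  Σ⁴-zero r₁ r₂ r₃ r₄ g≡0 =
    sumBox-zero r₁ λ x₁ → sumBox-zero r₂ λ x₂ → sumBox-zero r₃ λ x₃ → sumBox-zero r₄ λ x₄ → g≡0 x₁ x₂ x₃ x₄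

  Σ⁴-swap : ∀ r₁ r₂ r₃ r₄ (g : ℤ → ℤ → ℤ → ℤ → ℕ) →
            Σ⁴ r₁ r₂ r₃ r₄ (λ x₁ x₂ x₃ x₄ → g x₂ x₁ x₄ x₃) ≡ Σ⁴ r₂ r₁ r₄ r₃ g
  Σ⁴-swap r₁ r₂ r₃ r₄ g =
    trans (sumBox-comm r₁ r₂ _) (sumBox-cong r₂ λ x₂ → sumBox-cong r₁ λ x₁ → sumBox-comm r₃ r₄ _)

  VanishesOutside : ℕ → (ℤ → ℤ → ℤ → ℤ → ℕ) → Set
  VanishesOutside s g = ∀ x₁ x₂ x₃ x₄ → s < ∣ x₁ ∣ ⊎ s < ∣ x₂ ∣ ⊎ s < ∣ x₃ ∣ ⊎ s < ∣ x₄ ∣ → g x₁ x₂ x₃ x₄ ≡ 0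

  Σ⁴-restrict : ∀ {s r₁ r₂ r₃ r₄ g} → s ≤ r₁ → s ≤ r₂ → s ≤ r₃ → s ≤ r₄ → VanishesOutside s g →
                Σ⁴ r₁ r₂ r₃ r₄ g ≡ Σ⁴ s s s s g
  Σ⁴-restrict {s} {r₁} {r₂} {r₃} {r₄} s≤r₁ s≤r₂ s≤r₃ s≤r₄ vanish =
    trans (sumBox-restrict s≤r₁ λ x₁ out → sumBox-zero r₂ λ x₂ → sumBox-zero r₃ λ x₃ → sumBox-zero r₄ λ x₄ →
                                           vanish x₁ x₂ x₃ x₄ (inj₁ out)) $
    sumBox-cong s λ x₁ →
    trans (sumBox-restrict s≤r₂ λ x₂ out → sumBox-zero r₃ λ x₃ → sumBox-zero r₄ λ x₄ →
                                           vanish x₁ x₂ x₃ x₄ (inj₂ (inj₁ out))) $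
    sumBox-cong s λ x₂ →
    trans (sumBox-restrict s≤r₃ λ x₃ out → sumBox-zero r₄ λ x₄ → vanish x₁ x₂ x₃ x₄ (inj₂ (inj₂ (inj₁ out)))) $
    sumBox-cong s λ x₃ →
    sumBox-restrict s≤r₄ λ x₄ out → vanish x₁ x₂ x₃ x₄ (inj₂ (inj₂ (inj₂ out)))

  Σ⁴-split₁₃ : ∀ K {r₂ r₄} {g : ℤ → ℤ → ℤ → ℤ → ℕ} →
    (∀ x₂ x₃ x₄ → g -[1+ 2 * K ] x₂ x₃ x₄ ≡ 0) → (∀ x₁ x₂ x₄ → g x₁ x₂ -[1+ 2 * K ] x₄ ≡ 0) →
    Σ⁴ (2 * K) r₂ (2 * K) r₄ g ≡
      sumParity λ p → sumParity λ q → Σ⁴ K r₂ K r₄ (λ x₁ x₂ x₃ x₄ → g (embed p x₁) x₂ (embed q x₃) x₄)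
  Σ⁴-split₁₃ K {r₂} {r₄} {g} g₁≡0 g₃≡0 =
    trans (sumBox-split K (sumBox-zero r₂ λ x₂ → sumBox-zero (2 * K) λ x₃ → sumBox-zero r₄ λ x₄ → g₁≡0 x₂ x₃ x₄)) $
    sumParity-cong λ p →
    trans (sumBox-cong K λ x₁ → split₃ (embed p x₁)) $
    sumBox-sumParity K λ x₁ q → sumBox r₂ λ x₂ → sumBox K λ x₃ → sumBox r₄ (g (embed p x₁) x₂ (embed q x₃))
    where
    split₃ : ∀ x₁ → sumBox r₂ (λ x₂ → sumBox (2 * K) λ x₃ → sumBox r₄ (g x₁ x₂ x₃)) ≡
                    sumParity λ q → sumBox r₂ λ x₂ → sumBox K λ x₃ → sumBox r₄ (g x₁ x₂ (embed q x₃))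
    split₃ x₁ =
      trans (sumBox-cong r₂ λ x₂ → sumBox-split K (sumBox-zero r₄ (g₃≡0 x₁ x₂))) $
      sumBox-sumParity r₂ λ x₂ q → sumBox K λ x₃ → sumBox r₄ (g x₁ x₂ (embed q x₃))

  Σ⁴-split₂₄ : ∀ K {r₁ r₃} {g : ℤ → ℤ → ℤ → ℤ → ℕ} →
    (∀ x₁ x₃ x₄ → g x₁ -[1+ 2 * K ] x₃ x₄ ≡ 0) → (∀ x₁ x₂ x₃ → g x₁ x₂ x₃ -[1+ 2 * K ] ≡ 0) →
    Σ⁴ r₁ (2 * K) r₃ (2 * K) g ≡
      sumParity λ p → sumParity λ q → Σ⁴ r₁ K r₃ K (λ x₁ x₂ x₃ x₄ → g x₁ (embed p x₂) x₃ (embed q x₄))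
  Σ⁴-split₂₄ K {r₁} {r₃} {g} g₂≡0 g₄≡0 = begin
    Σ⁴ r₁ (2 * K) r₃ (2 * K) g
      ≡⟨ sym (Σ⁴-swap (2 * K) r₁ (2 * K) r₃ g) ⟩
    Σ⁴ (2 * K) r₁ (2 * K) r₃ (λ x₂ x₁ x₄ x₃ → g x₁ x₂ x₃ x₄)
      ≡⟨ Σ⁴-split₁₃ K {r₁} {r₃} {λ x₂ x₁ x₄ x₃ → g x₁ x₂ x₃ x₄} (λ x₁ x₄ x₃ → g₂≡0 x₁ x₃ x₄) (λ x₂ x₁ x₃ → g₄≡0 x₁ x₂ x₃) ⟩
    (sumParity λ p → sumParity λ q → Σ⁴ K r₁ K r₃ (λ x₂ x₁ x₄ x₃ → g x₁ (embed p x₂) x₃ (embed q x₄)))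
      ≡⟨ sumParity-cong (λ p → sumParity-cong λ q → Σ⁴-swap K r₁ K r₃ λ x₁ x₂ x₃ x₄ → g x₁ (embed p x₂) x₃ (embed q x₄)) ⟩
    (sumParity λ p → sumParity λ q → Σ⁴ r₁ K r₃ K (λ x₁ x₂ x₃ x₄ → g x₁ (embed p x₂) x₃ (embed q x₄))) ∎
    where open ≡-Reasoning

  triangular : ℕ → ℕ
  triangular zero    = 0
  triangular (suc k) = suc k + triangular k

  triangular-double : ∀ k → triangular k * 2 ≡ k * suc k
  triangular-double zero    = refl
  triangular-double (suc k) = begin
    (suc k + triangular k) * 2      ≡⟨ ℕP.*-distribʳ-+ 2 (suc k) (triangular k) ⟩
    suc k * 2 + triangular k * 2    ≡⟨ cong (_+_ (suc k * 2)) (triangular-double k) ⟩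
    suc k * 2 + k * suc k           ≡⟨ collect k ⟩
    suc k * suc (suc k)             ∎
    where
    open ≡-Reasoning
    collect : ∀ k → suc k * 2 + k * suc k ≡ suc k * suc (suc k)
    collect = solve-∀

  triangular-≥ : ∀ k → k ≤ triangular k
  triangular-≥ zero    = z≤n
  triangular-≥ (suc k) = ℕP.m≤m+n (suc k) (triangular k)

  formℕ : ℕ → ℕ → ℕ → ℕ → ℕ → ℕ → ℕ
  formℕ a b u₁ u₂ u₃ u₄ = a * u₁ + 2 * a * u₂ + b * u₃ + 2 * b * u₄

  private
    ≤+ : ∀ {m n o} → m ≤ n → m ≤ n + o
    ≤+ = ℕP.m≤n⇒m≤n+o _

  <-formℕ : ∀ a b .{{_ : NonZero a}} .{{_ : NonZero b}} {m u₁ u₂ u₃ u₄} →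
            m < u₁ ⊎ m < u₂ ⊎ m < u₃ ⊎ m < u₄ → m < formℕ a b u₁ u₂ u₃ u₄
  <-formℕ a b {u₁ = u₁} (inj₁ m<u₁) =
    ℕP.<-≤-trans m<u₁ (≤+ (≤+ (≤+ (ℕP.m≤n*m u₁ a))))
  <-formℕ a b {u₁ = u₁} {u₂ = u₂} (inj₂ (inj₁ m<u₂)) =
    ℕP.<-≤-trans m<u₂ (≤+ (≤+ (ℕP.m≤n⇒m≤o+n (a * u₁) (ℕP.m≤n*m u₂ (2 * a) {{ℕP.m*n≢0 2 a}}))))
  <-formℕ a b {u₁ = u₁} {u₂ = u₂} {u₃ = u₃} (inj₂ (inj₂ (inj₁ m<u₃))) =
    ℕP.<-≤-trans m<u₃ (≤+ (ℕP.m≤n⇒m≤o+n (a * u₁ + 2 * a * u₂) (ℕP.m≤n*m u₃ b)))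
  <-formℕ a b {u₄ = u₄} (inj₂ (inj₂ (inj₂ m<u₄))) =
    ℕP.<-≤-trans m<u₄ (ℕP.m≤n⇒m≤o+n _ (ℕP.m≤n*m u₄ (2 * b) {{ℕP.m*n≢0 2 b}}))


-- Representations by the form A u₁ + 2A u₂ + B u₃ + 2B u₄

module _ where
  open import Data.Integer using (_+_; _*_; _-_; -_)
  open import Data.Integer.DivMod using (_/_; div-pos-is-/ℕ)
  open import Data.Nat.DivMod using (m*n/n≡m)
  open import Data.Integer.Tactic.RingSolver using (solve-∀; solve)
  open import Data.Bool using (if_then_else_)
  open import Relation.Nullary using (yes; no; ¬_; contradiction)
  open import Relation.Nullary.Decidable using (⌊_⌋)

  -- the base case of countBox, so that countBox unfolds to nested sumBox's of δ
  δ : ℤ → ℕ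
  δ e = if ⌊ e ℤ.≟ + 0 ⌋ then 1 else 0

  δ-≢0 : ∀ {e} → ¬ e ≡ + 0 → δ e ≡ 0
  δ-≢0 {e} e≢0 with e ℤ.≟ + 0
  ... | yes e≡0 = contradiction e≡0 e≢0
  ... | no  _   = refl

  δ-⇔ : ∀ {e e′} → (e ≡ + 0 → e′ ≡ + 0) → (e′ ≡ + 0 → e ≡ + 0) → δ e ≡ δ e′
  δ-⇔ {e} {e′} to from with e ℤ.≟ + 0 | e′ ℤ.≟ + 0
  ... | yes _   | yes _    = refl
  ... | no  _   | no  _    = refl
  ... | yes e≡0 | no  e′≢0 = contradiction (to e≡0) e′≢0
  ... | no  e≢0 | yes e′≡0 = contradiction (from e′≡0) e≢0

  δ-scale : ∀ k .{{_ : NonZero k}} {e w} → e ≡ + k * w → δ e ≡ δ w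
  δ-scale k {w = w} refl = δ-⇔ cancel (λ w≡0 → trans (cong (λ v → + k * v) w≡0) (ℤP.*-zeroʳ (+ k)))
    where
    cancel : + k * w ≡ + 0 → w ≡ + 0
    cancel kw≡0 with ℤP.i*j≡0⇒i≡0∨j≡0 (+ k) kw≡0
    ... | inj₁ k≡0 = contradiction (ℤP.+-injective k≡0) (ℕ.≢-nonZero⁻¹ k)
    ... | inj₂ w≡0 = w≡0

  δ-odd : ∀ {e} → (∃ λ w → e ≡ + 2 * w + + 1) → δ e ≡ 0
  δ-odd (w , refl) = δ-≢0 λ 2w+1≡0 →
    ℕP.even≢odd ∣ - w ∣ 0 (sym (trans (cong ∣_∣ (1≡2[-w] 2w+1≡0)) (ℤP.abs-* (+ 2) (- w))))
    where
    1≡2[-w] : + 2 * w + + 1 ≡ + 0 → + 1 ≡ + 2 * (- w)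
    1≡2[-w] 2w+1≡0 = begin
      + 1                               ≡⟨ solve (w ∷ []) ⟩
      (+ 2 * w + + 1) + + 2 * (- w)     ≡⟨ cong (_+ + 2 * (- w)) 2w+1≡0 ⟩
      + 0 + + 2 * (- w)                 ≡⟨ ℤP.+-identityˡ _ ⟩
      + 2 * (- w)                       ∎
      where open ≡-Reasoning

  δ-multiple-of-odd : ∀ k .{{_ : NonZero k}} {e} → (∃ λ w → e ≡ + k * (+ 2 * w + + 1)) → δ e ≡ 0
  δ-multiple-of-odd k (w , e≡) = trans (δ-scale k e≡) (δ-odd (w , refl))

  triℕ : ℤ → ℕ
  triℕ (+ zero)  = 0
  triℕ (+ suc k) = triangular k
  triℕ -[1+ k ]  = triangular (suc k)

  x[x-1]≡2·triℕ : ∀ x → x * (x - + 1) ≡ + (triℕ x ℕ.* 2)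
  x[x-1]≡2·triℕ (+ zero)  = refl
  x[x-1]≡2·triℕ (+ suc k) =
    trans (sym (ℤP.pos-* (suc k) k)) (cong +_ (trans (ℕP.*-comm (suc k) k) (sym (triangular-double k))))
  x[x-1]≡2·triℕ -[1+ k ]  =
    cong +_ (trans (cong (λ j → suc k ℕ.* suc (suc j)) (ℕP.+-identityʳ k)) (sym (triangular-double (suc k))))

  tri≡triℕ : ∀ x → tri x ≡ + triℕ x
  tri≡triℕ x = begin
    x * (x - + 1) / + 2         ≡⟨ cong (_/ + 2) (x[x-1]≡2·triℕ x) ⟩
    + (triℕ x ℕ.* 2) / + 2      ≡⟨ div-pos-is-/ℕ (+ (triℕ x ℕ.* 2)) 2 ⟩
    + (triℕ x ℕ.* 2 ℕ./ 2)      ≡⟨ cong +_ (m*n/n≡m (triℕ x) 2) ⟩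
    + triℕ x                    ∎
    where open ≡-Reasoning

  triℕ-grows : ∀ {m} x → suc m < ∣ x ∣ → m < triℕ x
  triℕ-grows (+ suc k) (s≤s m<k) = ℕP.<-≤-trans m<k (triangular-≥ k)
  triℕ-grows -[1+ k ]  (s≤s m<k) = ℕP.<-≤-trans (ℕP.m<n⇒m<1+n m<k) (triangular-≥ (suc k))

  sq≡∣x∣² : ∀ x → sq x ≡ + (∣ x ∣ ℕ.* ∣ x ∣)
  sq≡∣x∣² (+ k)    = sym (ℤP.pos-* k k)
  sq≡∣x∣² -[1+ k ] = refl

  ∣x∣²-grows : ∀ {m} x → m < ∣ x ∣ → m < ∣ x ∣ ℕ.* ∣ x ∣
  ∣x∣²-grows x m<∣x∣ = ℕP.<-≤-trans m<∣x∣ (ℕP.m≤m*n ∣ x ∣ ∣ x ∣ {{ℕ.>-nonZero (ℕP.m<n⇒0<n m<∣x∣)}})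

  sq-double : ∀ z → sq (+ 2 * z) ≡ + 4 * sq z
  sq-double = expand
    where
    expand : ∀ z → (+ 2 * z) * (+ 2 * z) ≡ + 4 * (z * z)
    expand = solve-∀

  sq-odd : ∀ y → sq (+ 2 * y - + 1) ≡ + 8 * tri y + + 1
  sq-odd y = begin
    sq (+ 2 * y - + 1)                  ≡⟨ expand y ⟩
    + 4 * (y * (y - + 1)) + + 1         ≡⟨ cong (λ v → + 4 * v + + 1) (x[x-1]≡2·triℕ y) ⟩
    + 4 * + (triℕ y ℕ.* 2) + + 1        ≡⟨ cong (λ v → + 4 * v + + 1) (ℤP.pos-* (triℕ y) 2) ⟩
    + 4 * (+ triℕ y * + 2) + + 1        ≡⟨ collect (+ triℕ y) ⟩
    + 8 * + triℕ y + + 1                ≡⟨ cong (λ v → + 8 * v + + 1) (sym (tri≡triℕ y)) ⟩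
    + 8 * tri y + + 1                   ∎
    where
    open ≡-Reasoning
    expand : ∀ y → (+ 2 * y - + 1) * (+ 2 * y - + 1) ≡ + 4 * (y * (y - + 1)) + + 1
    expand = solve-∀
    collect : ∀ t → + 4 * (t * + 2) + + 1 ≡ + 8 * t + + 1
    collect = solve-∀

  -- INLINE lets the ring solver see through form
  form : ℤ → ℤ → ℤ → ℤ → ℤ → ℤ → ℤ
  form A B u₁ u₂ u₃ u₄ = A * u₁ + + 2 * A * u₂ + B * u₃ + + 2 * B * u₄
  {-# INLINE form #-}

  form-pos : ∀ a b u₁ u₂ u₃ u₄ → form (+ a) (+ b) (+ u₁) (+ u₂) (+ u₃) (+ u₄) ≡ + formℕ a b u₁ u₂ u₃ u₄
  form-pos a b u₁ u₂ u₃ u₄ = sym $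
    trans (ℤP.pos-+ (t₁ ℕ.+ t₂ ℕ.+ t₃) t₄) $ cong₂ _+_ (trans (ℤP.pos-+ (t₁ ℕ.+ t₂) t₃) $
      cong₂ _+_ (trans (ℤP.pos-+ t₁ t₂) $ cong₂ _+_ (ℤP.pos-* a u₁) (pos-*₃ 2 a u₂)) (ℤP.pos-* b u₃)) (pos-*₃ 2 b u₄)
    where
    t₁ = a ℕ.* u₁
    t₂ = 2 ℕ.* a ℕ.* u₂
    t₃ = b ℕ.* u₃
    t₄ = 2 ℕ.* b ℕ.* u₄
    pos-*₃ : ∀ i j k → + (i ℕ.* j ℕ.* k) ≡ + i * + j * + k
    pos-*₃ i j k = trans (ℤP.pos-* (i ℕ.* j) k) (cong (_* + k) (ℤP.pos-* i j))

  δ-form-cong : ∀ m A B {u₁ u₂ u₃ u₄ v₁ v₂ v₃ v₄} → u₁ ≡ v₁ → u₂ ≡ v₂ → u₃ ≡ v₃ → u₄ ≡ v₄ →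
                δ (m - form A B u₁ u₂ u₃ u₄) ≡ δ (m - form A B v₁ v₂ v₃ v₄)
  δ-form-cong _ _ _ refl refl refl refl = refl

  isRep : ℤ → ℤ → ℤ → (ℤ → ℤ) → ℤ → ℤ → ℤ → ℤ → ℕ
  isRep A B m f x₁ x₂ x₃ x₄ = δ (m - form A B (f x₁) (f x₂) (f x₃) (f x₄))

  countBox≡Σ⁴ : ∀ f B a b m → countBox f B (a ∷ 2 ℕ.* a ∷ b ∷ 2 ℕ.* b ∷ []) m ≡ Σ⁴ B B B B (isRep (+ a) (+ b) m f)
  countBox≡Σ⁴ f B a b m = Σ⁴-cong B B B B {g = λ x₁ x₂ x₃ x₄ → δ (m - + a * f x₁ - + (2 ℕ.* a) * f x₂ - + b * f x₃ - + (2 ℕ.* b) * f x₄)}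
    λ x₁ x₂ x₃ x₄ → cong δ (trans
      (cong₂ (λ A₂ B₂ → m - + a * f x₁ - A₂ * f x₂ - + b * f x₃ - B₂ * f x₄) (ℤP.pos-* 2 a) (ℤP.pos-* 2 b))
      (collect m (+ a) (+ b) (f x₁) (f x₂) (f x₃) (f x₄)))
    where
    collect : ∀ m A B u₁ u₂ u₃ u₄ → m - A * u₁ - + 2 * A * u₂ - B * u₃ - + 2 * B * u₄ ≡ m - form A B u₁ u₂ u₃ u₄
    collect = solve-∀

  isRep-vanishesOutside : ∀ {a b} .{{_ : NonZero a}} .{{_ : NonZero b}} {m r f} (φ : ℤ → ℕ) →
    (∀ x → f x ≡ + φ x) → (∀ x → r < ∣ x ∣ → m < φ x) → VanishesOutside r (isRep (+ a) (+ b) (+ m) f)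
  isRep-vanishesOutside {a} {b} {m} {r} {f} φ f≡φ grows x₁ x₂ x₃ x₄ outside = δ-≢0 λ e≡0 →
    ℕP.<-irrefl (ℤP.+-injective (m≡form e≡0))
                (<-formℕ a b (Sum.map (grows x₁) (Sum.map (grows x₂) (Sum.map (grows x₃) (grows x₄))) outside))
    where
    m≡form : + m - form (+ a) (+ b) (f x₁) (f x₂) (f x₃) (f x₄) ≡ + 0 → + m ≡ + formℕ a b (φ x₁) (φ x₂) (φ x₃) (φ x₄)
    m≡form e≡0 = begin
      + m                                           ≡⟨ ℤP.i-j≡0⇒i≡j _ _ e≡0 ⟩
      form (+ a) (+ b) (f x₁) (f x₂) (f x₃) (f x₄)   ≡⟨ cong₂ (λ u₁ u₂ → form (+ a) (+ b) u₁ u₂ (f x₃) (f x₄)) (f≡φ x₁) (f≡φ x₂) ⟩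
      form (+ a) (+ b) (+ φ x₁) (+ φ x₂) (f x₃) (f x₄) ≡⟨ cong₂ (λ u₃ u₄ → form (+ a) (+ b) (+ φ x₁) (+ φ x₂) u₃ u₄) (f≡φ x₃) (f≡φ x₄) ⟩
      form (+ a) (+ b) (+ φ x₁) (+ φ x₂) (+ φ x₃) (+ φ x₄) ≡⟨ form-pos a b (φ x₁) (φ x₂) (φ x₃) (φ x₄) ⟩
      + formℕ a b (φ x₁) (φ x₂) (φ x₃) (φ x₄)        ∎
      where open ≡-Reasoning

  odd-of-congruent : ∀ {A B} β d → B ≡ + 2 * β + + 1 → A ≡ B + + 4 * d → A ≡ + 2 * (β + + 2 * d) + + 1
  odd-of-congruent β d refl refl = solve (β ∷ d ∷ [])

  pos-8n+3[a+b] : ∀ n a b → + (8 ℕ.* n ℕ.+ 3 ℕ.* (a ℕ.+ b)) ≡ + 8 * + n + + 3 * (+ a + + b)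
  pos-8n+3[a+b] n a b =
    trans (ℤP.pos-+ (8 ℕ.* n) _) (cong₂ _+_ (ℤP.pos-* 8 n) (trans (ℤP.pos-* 3 (a ℕ.+ b)) (cong (+ 3 *_) (ℤP.pos-+ a b))))

  pos-1+q*2 : ∀ q → + (1 ℕ.+ q ℕ.* 2) ≡ + 2 * + q + + 1
  pos-1+q*2 q = trans (cong (λ v → + 1 + v) (ℤP.pos-* q 2)) (shuffle (+ q))
    where
    shuffle : ∀ x → + 1 + x * + 2 ≡ + 2 * x + + 1
    shuffle = solve-∀

  i-j≡q*4⇒i≡j+4q : ∀ i j q → i - j ≡ q * + 4 → i ≡ j + + 4 * q
  i-j≡q*4⇒i≡j+4q i j q i-j≡ = begin
    i               ≡⟨ solve (i ∷ j ∷ []) ⟩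
    (i - j) + j     ≡⟨ cong (_+ j) i-j≡ ⟩
    q * + 4 + j     ≡⟨ solve (q ∷ j ∷ []) ⟩
    j + + 4 * q     ∎
    where open ≡-Reasoning

  [m+n]-m≡n : ∀ m n → + (m ℕ.+ n) - + m ≡ + n
  [m+n]-m≡n m n = trans (cong (_- + m) (ℤP.pos-+ m n)) (cancel (+ m) (+ n))
    where
    cancel : ∀ x y → x + y - x ≡ y
    cancel = solve-∀

  -- In the names below E/O is the parity of x₁ … x₄ (· : not split), and the arguments are
  -- sᵢ = zᵢ² for xᵢ = 2zᵢ, tᵢ = tri yᵢ for xᵢ = 2yᵢ - 1 (so xᵢ² = 4sᵢ resp. 8tᵢ + 1), uᵢ = xᵢ².
  halve-E·E· : ∀ {m} A B K → m ≡ + 2 * K → ∀ s₁ u₂ s₃ u₄ →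
               m - form A B (+ 4 * s₁) u₂ (+ 4 * s₃) u₄ ≡ + 2 * (K - form A B u₂ s₁ u₄ s₃)
  halve-E·E· A B K refl s₁ u₂ s₃ u₄ = solve (A ∷ B ∷ K ∷ s₁ ∷ u₂ ∷ s₃ ∷ u₄ ∷ [])

  odd-E·O· : ∀ {m} A B K β → m ≡ + 2 * K → B ≡ + 2 * β + + 1 → ∀ s₁ u₂ t₃ u₄ →
             ∃ λ w → m - form A B (+ 4 * s₁) u₂ (+ 8 * t₃ + + 1) u₄ ≡ + 2 * w + + 1
  odd-E·O· A B K β refl refl s₁ u₂ t₃ u₄ =
    K - β - + 1 - (+ 2 * A * s₁ + A * u₂ + + 4 * B * t₃ + B * u₄) , solve (A ∷ K ∷ β ∷ s₁ ∷ u₂ ∷ t₃ ∷ u₄ ∷ [])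

  odd-O·E· : ∀ {m} A B K α → m ≡ + 2 * K → A ≡ + 2 * α + + 1 → ∀ t₁ u₂ s₃ u₄ →
             ∃ λ w → m - form A B (+ 8 * t₁ + + 1) u₂ (+ 4 * s₃) u₄ ≡ + 2 * w + + 1
  odd-O·E· A B K α refl refl t₁ u₂ s₃ u₄ =
    K - α - + 1 - (+ 4 * A * t₁ + A * u₂ + + 2 * B * s₃ + B * u₄) , solve (B ∷ K ∷ α ∷ t₁ ∷ u₂ ∷ s₃ ∷ u₄ ∷ [])

  twice-odd-OEOO : ∀ {m} A B n α → m ≡ + 8 * n + + 3 * (A + B) → A ≡ + 2 * α + + 1 → ∀ t₁ s₂ t₃ t₄ →
    ∃ λ w → m - form A B (+ 8 * t₁ + + 1) (+ 4 * s₂) (+ 8 * t₃ + + 1) (+ 8 * t₄ + + 1) ≡ + 2 * (+ 2 * w + + 1)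
  twice-odd-OEOO A B n α refl refl t₁ s₂ t₃ t₄ =
    + 2 * (n - (A * t₁ + A * s₂ + B * t₃ + + 2 * B * t₄)) + α , solve (B ∷ n ∷ α ∷ t₁ ∷ s₂ ∷ t₃ ∷ t₄ ∷ [])

  twice-odd-OOOE : ∀ {m} A B n β → m ≡ + 8 * n + + 3 * (A + B) → B ≡ + 2 * β + + 1 → ∀ t₁ t₂ t₃ s₄ →
    ∃ λ w → m - form A B (+ 8 * t₁ + + 1) (+ 8 * t₂ + + 1) (+ 8 * t₃ + + 1) (+ 4 * s₄) ≡ + 2 * (+ 2 * w + + 1)
  twice-odd-OOOE A B n β refl refl t₁ t₂ t₃ s₄ =
    + 2 * (n - (A * t₁ + + 2 * A * t₂ + B * t₃ + B * s₄)) + β , solve (A ∷ n ∷ β ∷ t₁ ∷ t₂ ∷ t₃ ∷ s₄ ∷ [])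

  -- the only case that needs a ≡ b (mod 4)
  four-times-odd-OEOE : ∀ {m} A B n β d → m ≡ + 8 * n + + 3 * (A + B) → B ≡ + 2 * β + + 1 → A ≡ B + + 4 * d →
    ∀ t₁ s₂ t₃ s₄ → ∃ λ w → m - form A B (+ 8 * t₁ + + 1) (+ 4 * s₂) (+ 8 * t₃ + + 1) (+ 4 * s₄) ≡ + 4 * (+ 2 * w + + 1)
  four-times-odd-OEOE A B n β d refl refl refl t₁ s₂ t₃ s₄ =
    n - (A * t₁ + A * s₂ + B * t₃ + B * s₄) + β + d , solve (n ∷ β ∷ d ∷ t₁ ∷ s₂ ∷ t₃ ∷ s₄ ∷ [])

  eighth-OOOO : ∀ {m} A B n → m ≡ + 8 * n + + 3 * (A + B) → ∀ t₁ t₂ t₃ t₄ →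
    m - form A B (+ 8 * t₁ + + 1) (+ 8 * t₂ + + 1) (+ 8 * t₃ + + 1) (+ 8 * t₄ + + 1) ≡ + 8 * (n - form A B t₁ t₂ t₃ t₄)
  eighth-OOOO A B n refl t₁ t₂ t₃ t₄ = solve (A ∷ B ∷ n ∷ t₁ ∷ t₂ ∷ t₃ ∷ t₄ ∷ [])

-- The doubling identity for N

open import Data.Nat using (_+_; _*_)

coeffs : ℕ → ℕ → List ℕ
coeffs a b = a ∷ 2 * a ∷ b ∷ 2 * b ∷ []

module _ {a b : ℕ} .{{_ : NonZero a}} .{{_ : NonZero b}} where

  private
    rep : ℤ → (ℤ → ℤ) → ℤ → ℤ → ℤ → ℤ → ℕ
    rep = isRep (+ a) (+ b)

  N≡Σ⁴ : ∀ m → N (coeffs a b) m ≡ Σ⁴ m m m m (rep (+ m) sq)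
  N≡Σ⁴ m = countBox≡Σ⁴ sq m a b (+ m)

  t≡Σ⁴ : ∀ n → t (coeffs a b) n ≡ Σ⁴ (suc n) (suc n) (suc n) (suc n) (rep (+ n) tri)
  t≡Σ⁴ n = countBox≡Σ⁴ tri (suc n) a b (+ n)

  sq-vanishesOutside : ∀ m → VanishesOutside m (rep (+ m) sq)
  sq-vanishesOutside m = isRep-vanishesOutside (λ x → ∣ x ∣ * ∣ x ∣) sq≡∣x∣² ∣x∣²-grows

  tri-vanishesOutside : ∀ n → VanishesOutside (suc n) (rep (+ n) tri)
  tri-vanishesOutside n = isRep-vanishesOutside triℕ tri≡triℕ triℕ-grows

  even-even-part : ∀ K →
    Σ⁴ K (2 * K) K (2 * K) (λ z₁ x₂ z₃ x₄ → rep (+ (2 * K)) sq (embed even z₁) x₂ (embed even z₃) x₄) ≡ N (coeffs a b) K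
  even-even-part K = begin
    Σ⁴ K (2 * K) K (2 * K) (λ z₁ x₂ z₃ x₄ → rep (+ (2 * K)) sq (embed even z₁) x₂ (embed even z₃) x₄)
      ≡⟨ Σ⁴-cong K (2 * K) K (2 * K) halve ⟩
    Σ⁴ K (2 * K) K (2 * K) (λ z₁ x₂ z₃ x₄ → rep (+ K) sq x₂ z₁ x₄ z₃)
      ≡⟨ Σ⁴-swap K (2 * K) K (2 * K) (rep (+ K) sq) ⟩
    Σ⁴ (2 * K) K (2 * K) K (rep (+ K) sq)
      ≡⟨ Σ⁴-restrict K≤2K ℕP.≤-refl K≤2K ℕP.≤-refl (sq-vanishesOutside K) ⟩
    Σ⁴ K K K K (rep (+ K) sq)
      ≡⟨ sym (N≡Σ⁴ K) ⟩
    N (coeffs a b) K ∎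
    where
    open ≡-Reasoning
    K≤2K = ℕP.m≤n*m K 2
    halve : ∀ z₁ x₂ z₃ x₄ → rep (+ (2 * K)) sq (embed even z₁) x₂ (embed even z₃) x₄ ≡ rep (+ K) sq x₂ z₁ x₄ z₃
    halve z₁ x₂ z₃ x₄ =
      trans (δ-form-cong (+ (2 * K)) (+ a) (+ b) (sq-double z₁) (refl {x = sq x₂}) (sq-double z₃) (refl {x = sq x₄}))
            (δ-scale 2 (halve-E·E· (+ a) (+ b) (+ K) (ℤP.pos-* 2 K) (sq z₁) (sq x₂) (sq z₃) (sq x₄)))

  module _ {n K : ℕ} (n<K : n < K) (2K≡ : 2 * K ≡ 8 * n + 3 * (a + b))
           (β d : ℤ) (b≡2β+1 : + b ≡ + 2 ℤ.* β ℤ.+ + 1) (a≡b+4d : + a ≡ + b ℤ.+ + 4 ℤ.* d) where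

    private
      M : ℤ
      M = + (2 * K)

      M≡2K : M ≡ + 2 ℤ.* + K
      M≡2K = ℤP.pos-* 2 K

      M≡8n+3[a+b] : M ≡ + 8 ℤ.* + n ℤ.+ + 3 ℤ.* (+ a ℤ.+ + b)
      M≡8n+3[a+b] = trans (cong +_ 2K≡) (pos-8n+3[a+b] n a b)

      a≡2α+1 : + a ≡ + 2 ℤ.* (β ℤ.+ + 2 ℤ.* d) ℤ.+ + 1
      a≡2α+1 = odd-of-congruent β d b≡2β+1 a≡b+4d

      boundary : VanishesOutside (2 * K) (rep M sq)
      boundary = sq-vanishesOutside (2 * K)

      outside : 2 * K < ∣ -[1+ 2 * K ] ∣
      outside = ℕP.n<1+n (2 * K)

    even-odd-part : Σ⁴ K (2 * K) K (2 * K) (λ z₁ x₂ y₃ x₄ → rep M sq (embed even z₁) x₂ (embed odd y₃) x₄) ≡ 0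
    even-odd-part = Σ⁴-zero K (2 * K) K (2 * K) λ z₁ x₂ y₃ x₄ →
      trans (δ-form-cong M (+ a) (+ b) (sq-double z₁) (refl {x = sq x₂}) (sq-odd y₃) (refl {x = sq x₄}))
            (δ-odd (odd-E·O· (+ a) (+ b) (+ K) β M≡2K b≡2β+1 (sq z₁) (sq x₂) (tri y₃) (sq x₄)))

    odd-even-part : Σ⁴ K (2 * K) K (2 * K) (λ y₁ x₂ z₃ x₄ → rep M sq (embed odd y₁) x₂ (embed even z₃) x₄) ≡ 0
    odd-even-part = Σ⁴-zero K (2 * K) K (2 * K) λ y₁ x₂ z₃ x₄ →
      trans (δ-form-cong M (+ a) (+ b) (sq-odd y₁) (refl {x = sq x₂}) (sq-double z₃) (refl {x = sq x₄}))
            (δ-odd (odd-O·E· (+ a) (+ b) (+ K) (β ℤ.+ + 2 ℤ.* d) M≡2K a≡2α+1 (tri y₁) (sq x₂) (sq z₃) (sq x₄)))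

    odd-odd-part : Σ⁴ K (2 * K) K (2 * K) (λ y₁ x₂ y₃ x₄ → rep M sq (embed odd y₁) x₂ (embed odd y₃) x₄) ≡ t (coeffs a b) n
    odd-odd-part = begin
      Σ⁴ K (2 * K) K (2 * K) (λ y₁ x₂ y₃ x₄ → rep M sq (embed odd y₁) x₂ (embed odd y₃) x₄)
        ≡⟨ Σ⁴-split₂₄ K {K} {K} (λ y₁ y₃ x₄ → boundary (embed odd y₁) -[1+ 2 * K ] (embed odd y₃) x₄ (inj₂ (inj₁ outside)))
                           (λ y₁ x₂ y₃ → boundary (embed odd y₁) x₂ (embed odd y₃) -[1+ 2 * K ] (inj₂ (inj₂ (inj₂ outside)))) ⟩
      (sumParity λ p → sumParity λ q →
        Σ⁴ K K K K (λ y₁ x₂ y₃ x₄ → rep M sq (embed odd y₁) (embed p x₂) (embed odd y₃) (embed q x₄)))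
        ≡⟨ cong₂ _+_ (cong₂ _+_ OEOE OEOO) (cong₂ _+_ OOOE OOOO) ⟩
      Σ⁴ K K K K (rep (+ n) tri)
        ≡⟨ Σ⁴-restrict n<K n<K n<K n<K (tri-vanishesOutside n) ⟩
      Σ⁴ (suc n) (suc n) (suc n) (suc n) (rep (+ n) tri)
        ≡⟨ sym (t≡Σ⁴ n) ⟩
      t (coeffs a b) n ∎
      where
      open ≡-Reasoning
      OEOE : Σ⁴ K K K K (λ y₁ z₂ y₃ z₄ → rep M sq (embed odd y₁) (embed even z₂) (embed odd y₃) (embed even z₄)) ≡ 0
      OEOE = Σ⁴-zero K K K K λ y₁ z₂ y₃ z₄ →
        trans (δ-form-cong M (+ a) (+ b) (sq-odd y₁) (sq-double z₂) (sq-odd y₃) (sq-double z₄))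
              (δ-multiple-of-odd 4 (four-times-odd-OEOE (+ a) (+ b) (+ n) β d M≡8n+3[a+b] b≡2β+1 a≡b+4d
                                                        (tri y₁) (sq z₂) (tri y₃) (sq z₄)))
      OEOO : Σ⁴ K K K K (λ y₁ z₂ y₃ y₄ → rep M sq (embed odd y₁) (embed even z₂) (embed odd y₃) (embed odd y₄)) ≡ 0
      OEOO = Σ⁴-zero K K K K λ y₁ z₂ y₃ y₄ →
        trans (δ-form-cong M (+ a) (+ b) (sq-odd y₁) (sq-double z₂) (sq-odd y₃) (sq-odd y₄))
              (δ-multiple-of-odd 2 (twice-odd-OEOO (+ a) (+ b) (+ n) (β ℤ.+ + 2 ℤ.* d) M≡8n+3[a+b] a≡2α+1
                                                   (tri y₁) (sq z₂) (tri y₃) (tri y₄)))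
      OOOE : Σ⁴ K K K K (λ y₁ y₂ y₃ z₄ → rep M sq (embed odd y₁) (embed odd y₂) (embed odd y₃) (embed even z₄)) ≡ 0
      OOOE = Σ⁴-zero K K K K λ y₁ y₂ y₃ z₄ →
        trans (δ-form-cong M (+ a) (+ b) (sq-odd y₁) (sq-odd y₂) (sq-odd y₃) (sq-double z₄))
              (δ-multiple-of-odd 2 (twice-odd-OOOE (+ a) (+ b) (+ n) β M≡8n+3[a+b] b≡2β+1
                                                   (tri y₁) (tri y₂) (tri y₃) (sq z₄)))
      OOOO : Σ⁴ K K K K (λ y₁ y₂ y₃ y₄ → rep M sq (embed odd y₁) (embed odd y₂) (embed odd y₃) (embed odd y₄)) ≡
             Σ⁴ K K K K (rep (+ n) tri)
      OOOO = Σ⁴-cong K K K K λ y₁ y₂ y₃ y₄ →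
        trans (δ-form-cong M (+ a) (+ b) (sq-odd y₁) (sq-odd y₂) (sq-odd y₃) (sq-odd y₄))
              (δ-scale 8 (eighth-OOOO (+ a) (+ b) (+ n) M≡8n+3[a+b] (tri y₁) (tri y₂) (tri y₃) (tri y₄)))

    N-doubling : N (coeffs a b) (2 * K) ≡ N (coeffs a b) K + t (coeffs a b) n
    N-doubling = begin
      N (coeffs a b) (2 * K)
        ≡⟨ N≡Σ⁴ (2 * K) ⟩
      Σ⁴ (2 * K) (2 * K) (2 * K) (2 * K) (rep M sq)
        ≡⟨ Σ⁴-split₁₃ K {2 * K} {2 * K} (λ x₂ x₃ x₄ → boundary -[1+ 2 * K ] x₂ x₃ x₄ (inj₁ outside))
                                         (λ x₁ x₂ x₄ → boundary x₁ x₂ -[1+ 2 * K ] x₄ (inj₂ (inj₂ (inj₁ outside)))) ⟩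
      (sumParity λ p → sumParity λ q →
        Σ⁴ K (2 * K) K (2 * K) (λ x₁ x₂ x₃ x₄ → rep M sq (embed p x₁) x₂ (embed q x₃) x₄))
        ≡⟨ cong₂ _+_ (cong₂ _+_ (even-even-part K) even-odd-part) (cong₂ _+_ odd-even-part odd-odd-part) ⟩
      N (coeffs a b) K + 0 + t (coeffs a b) n
        ≡⟨ cong (_+ t (coeffs a b) n) (ℕP.+-identityʳ (N (coeffs a b) K)) ⟩
      N (coeffs a b) K + t (coeffs a b) n ∎
      where open ≡-Reasoning

open import Data.Nat using (_%_)
open import Data.Nat.DivMod using (_/_; m≡m%n+[m/n]*n; m%n<n; %-distribˡ-*; m*[n/m]≡n)
open import Data.Nat.Divisibility using (divides)
open import Data.Nat.Tactic.RingSolver using (solve-∀)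
open import Data.Integer using (_-_)
open import Data.Integer.Divisibility using (_∣_)
open import Data.Integer.Divisibility.Signed using (∣ᵤ⇒∣; quotient) renaming (module _∣_ to Signed∣)

odd-factor : ∀ a b → (a * b) % 2 ≡ 1 → a % 2 ≡ 1
odd-factor a b ab-odd with a % 2 | m%n<n a 2 | trans (sym (%-distribˡ-* a b 2)) ab-odd
... | 0           | _            | ()
... | 1           | _            | _ = refl
... | suc (suc _) | s≤s (s≤s ()) | _

odd⇒1+[m/2]*2 : ∀ m → m % 2 ≡ 1 → m ≡ 1 + m / 2 * 2
odd⇒1+[m/2]*2 m m-odd = trans (m≡m%n+[m/n]*n m 2) (cong (_+ m / 2 * 2) m-odd)

2*[3[a+b]/2] : ∀ a b → a % 2 ≡ 1 → b % 2 ≡ 1 → 2 * (3 * (a + b) / 2) ≡ 3 * (a + b)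
2*[3[a+b]/2] a b a-odd b-odd = m*[n/m]≡n (divides (3 * (1 + a / 2 + b / 2)) $
  trans (cong₂ (λ x y → 3 * (x + y)) (odd⇒1+[m/2]*2 a a-odd) (odd⇒1+[m/2]*2 b b-odd)) (collect (a / 2) (b / 2)))
  where
  collect : ∀ α β → 3 * ((1 + α * 2) + (1 + β * 2)) ≡ 3 * (1 + α + β) * 2
  collect = solve-∀

theorem5p14 : (a b n : ℕ) → .{{NonZero a}} → .{{NonZero b}} → .{{NonZero n}} →
    (a * b) % 2 ≡ 1 → (+ 4) ∣ (+ a - + b) →
    + t (a ∷ 2 * a ∷ b ∷ 2 * b ∷ []) n ≡
      + N (a ∷ 2 * a ∷ b ∷ 2 * b ∷ []) (8 * n + 3 * (a + b))
      - + N (a ∷ 2 * a ∷ b ∷ 2 * b ∷ []) (4 * n + (3 * (a + b)) / 2)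
theorem5p14 a b n ab-odd 4∣a-b = begin
  + t cs n                                     ≡⟨ sym ([m+n]-m≡n (N cs K) (t cs n)) ⟩
  + (N cs K + t cs n) - + N cs K                ≡⟨ cong (λ m → + m - + N cs K) (sym doubling) ⟩
  + N cs (2 * K) - + N cs K                     ≡⟨ cong (λ m → + N cs m - + N cs K) 2K≡ ⟩
  + N cs (8 * n + 3 * (a + b)) - + N cs K       ∎
  where
  open ≡-Reasoning
  cs = coeffs a b
  a-odd = odd-factor a b ab-odd
  b-odd = odd-factor b a (trans (cong (_% 2) (ℕP.*-comm b a)) ab-odd)

  K = 4 * n + 3 * (a + b) / 2
  2K≡ : 2 * K ≡ 8 * n + 3 * (a + b)
  2K≡ = trans (ℕP.*-distribˡ-+ 2 (4 * n) (3 * (a + b) / 2))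
              (cong₂ _+_ (sym (ℕP.*-assoc 2 4 n)) (2*[3[a+b]/2] a b a-odd b-odd))
  n<K : n < K
  n<K = ℕP.<-≤-trans (ℕP.m<m*n n 4 (s≤s (s≤s z≤n)))
                     (ℕP.≤-trans (ℕP.≤-reflexive (ℕP.*-comm n 4)) (ℕP.m≤m+n (4 * n) _))

  b≡2β+1 : + b ≡ + 2 ℤ.* + (b / 2) ℤ.+ + 1
  b≡2β+1 = trans (cong +_ (odd⇒1+[m/2]*2 b b-odd)) (pos-1+q*2 (b / 2))
  4∣ₛa-b = ∣ᵤ⇒∣ {+ 4} {+ a - + b} 4∣a-b
  a≡b+4d : + a ≡ + b ℤ.+ + 4 ℤ.* quotient 4∣ₛa-b
  a≡b+4d = i-j≡q*4⇒i≡j+4q (+ a) (+ b) (quotient 4∣ₛa-b) (Signed∣.equality 4∣ₛa-b)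

  doubling : N cs (2 * K) ≡ N cs K + t cs n
  doubling = N-doubling n<K 2K≡ (+ (b / 2)) (quotient 4∣ₛa-b) b≡2β+1 a≡b+4d
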